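{- Let $p\in\mathcal P_{cons}$. Then there exists an integer $x$ such that $x$ and $1-x$ are nonzero $p$th powers modulo $p^2$ and $1-x$ has even multiplicative order modulo $p^2$.
   Context: An integer $y$ is a nonzero $p$th power modulo $p^2$ if $y\equiv a^p\pmod{p^2}$ for some integer $a$ and $p\nmid y$; two $p$th powers $x,y$ modulo $p^2$ are consecutive if $y-x\equiv\pm1\pmod{p^2}$. $\mathcal P_{cons}$ is the set of primes $p$ for which there exist two consecutive nonzero $p$th powers modulo $p^2$. -}

module Defs where

open import Data.Nat using (ℕ; suc; _<_; _*_)
open import Data.Nat.Primality using (Prime)
open import Data.Integer using (ℤ; +_; _-_; _^_; -_)
open import Data.Integer.Divisibility using (_∣_)
open import Data.Product using (Σ; ∃; _×_; _,_)
open import Data.Sum using (_⊎_)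
open import Relation.Nullary using (¬_)
open import Data.Nat.Divisibility using () renaming (_∣_ to _∣ℕ_)

_≡_[mod_] : ℤ → ℤ → ℕ → Set
x ≡ y [mod m ] = (+ m) ∣ (x - y)

NonzeroPthPowerMod : ℕ → ℤ → Set
NonzeroPthPowerMod p y = (∃ λ (a : ℤ) → y ≡ a ^ p [mod p * p ]) × ¬ ((+ p) ∣ y)

Consecutive : ℕ → ℤ → ℤ → Set
Consecutive p x y = ((y - x) ≡ + 1 [mod p * p ]) ⊎ ((y - x) ≡ - (+ 1) [mod p * p ])

InPcons : ℕ → Set
InPcons p = Prime p ×
  (∃ λ (x : ℤ) → ∃ λ (y : ℤ) →
     NonzeroPthPowerMod p x × NonzeroPthPowerMod p y × Consecutive p x y)

IsMultOrder : ℕ → ℤ → ℕ → Set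
IsMultOrder m y k =
  0 < k × (y ^ k) ≡ + 1 [mod m ] ×
  (∀ j → 0 < j → j < k → ¬ ((y ^ j) ≡ + 1 [mod m ]))

HasEvenMultOrder : ℕ → ℤ → Set
HasEvenMultOrder m y = ∃ λ k → IsMultOrder m y k × (2 ∣ℕ k)

{-# OPTIONS --safe #-}
module Submission where

-- For odd p the nonzero p-th powers modulo p² form a multiplicative group containing -1, so
-- consecutive ones x, y give 1 ≡ P + Q with P, Q nonzero p-th powers (P = -x, Q = y or
-- P = -y, Q = x).  If Q (or P) has even order, take the other summand as the witness.  If the
-- orders n, m of P, Q are both odd, put I = P⁻¹: then 1 ≡ I + w with w = -QI, and since nm is
-- odd, w^(nm) ≡ -1, so w has even order.  For p = 2 there is nothing to prove: nonzero squares
-- are ≡ 1 modulo 4, so no two of them are consecutive.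

open import Data.Empty using (⊥; ⊥-elim)
open import Data.Fin using (toℕ; fromℕ<)
open import Data.Fin.Properties using (pigeonhole; toℕ-fromℕ<)
open import Data.Integer
  using (ℤ; +_; -_; _+_; _-_; _^_; ∣_∣; _%ℕ_; _/ℕ_; 0ℤ; 1ℤ; -1ℤ) renaming (_*_ to _·_)
import Data.Integer.Properties as ℤ
open import Data.Integer.DivMod using (a≡a%ℕn+[a/ℕn]*n; n%ℕd<d)
import Data.Integer.Divisibility as ℤ∣
import Data.Integer.Divisibility.Signed as ℤ∣ₛ
open import Data.Integer.Tactic.RingSolver using (solve-∀)
open import Data.Nat as ℕ using (ℕ; zero; suc; NonZero; _*_; _<_; s≤s)
import Data.Nat.Properties as ℕ
open import Data.Nat.Divisibility as ℕ∣ using (_∣_; _∣?_; divides)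
open import Data.Nat.Induction using (<-rec)
open import Data.Nat.Primality using (Prime; euclidsLemma; prime⇒irreducible; prime[2]; prime⇒nonZero; prime⇒nonTrivial)
open import Data.Product using (∃; ∃₂; _×_; _,_; proj₂)
open import Data.Sum using (inj₁; inj₂)
open import Function using (_∘_)
open import Relation.Binary using (Setoid; IsEquivalence)
import Relation.Binary.Reasoning.Setoid
open import Relation.Binary.PropositionalEquality using (_≡_; _≢_; refl; sym; trans; cong; subst; module ≡-Reasoning)
open import Relation.Nullary using (¬_; Dec; yes; no; contradiction)
open import Relation.Nullary.Decidable using (_×-dec_; map′)
open import Relation.Unary using (Pred; Decidable)

open import Defs

Least : ∀ {ℓ} → Pred ℕ ℓ → Pred ℕ ℓ
Least P k = P k × (∀ j → j < k → ¬ P j)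

least-such : ∀ {ℓ} {P : Pred ℕ ℓ} → Decidable P → ∀ {n} → P n → ∃ (Least P)
least-such {P = P} P? {n} = <-rec (λ n → P n → ∃ (Least P)) step n
  where
  step : ∀ n → (∀ {j} → j < n → P j → ∃ (Least P)) → P n → ∃ (Least P)
  step n smaller Pn with ℕ.anyUpTo? P? n
  ... | yes (j , j<n , Pj) = smaller j<n Pj
  ... | no none = n , Pn , λ j j<n Pj → none (j , j<n , Pj)

^-distribʳ-* : ∀ a b n → (a · b) ^ n ≡ a ^ n · b ^ n
^-distribʳ-* a b zero = refl
^-distribʳ-* a b (suc n) = trans (cong ((a · b) ·_) (^-distribʳ-* a b n)) (interchange a b (a ^ n) (b ^ n))
  where
  interchange : ∀ a b c d → (a · b) · (c · d) ≡ (a · c) · (b · d)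
  interchange = solve-∀

-1^odd : ∀ k → ¬ 2 ∣ k → -1ℤ ^ k ≡ -1ℤ
-1^odd 0 2∤0 = contradiction (2 ℕ∣.∣0) 2∤0
-1^odd 1 _ = refl
-1^odd (suc (suc k)) 2∤k+2 = trans (-1*-1* (-1ℤ ^ k)) (-1^odd k (2∤k+2 ∘ ℕ∣.∣m∣n⇒∣m+n ℕ∣.∣-refl))
  where
  -1*-1* : ∀ x → -1ℤ · (-1ℤ · x) ≡ x
  -1*-1* = solve-∀

-‿^-odd : ∀ a k → ¬ 2 ∣ k → (- a) ^ k ≡ - (a ^ k)
-‿^-odd a k 2∤k = begin
  (- a) ^ k           ≡⟨ cong (_^ k) (sym (ℤ.-1*i≡-i a)) ⟩
  (-1ℤ · a) ^ k       ≡⟨ ^-distribʳ-* -1ℤ a k ⟩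
  -1ℤ ^ k · a ^ k     ≡⟨ cong (_· a ^ k) (-1^odd k 2∤k) ⟩
  -1ℤ · a ^ k         ≡⟨ ℤ.-1*i≡-i (a ^ k) ⟩
  - (a ^ k)           ∎
  where open ≡-Reasoning

odd*odd : ∀ m n → ¬ 2 ∣ m → ¬ 2 ∣ n → ¬ 2 ∣ m * n
odd*odd m n 2∤m 2∤n 2∣mn with euclidsLemma m n prime[2] 2∣mn
... | inj₁ 2∣m = 2∤m 2∣m
... | inj₂ 2∣n = 2∤n 2∣n

module Congruence (m : ℕ) where

  infix 4 _≈_ _≈?_
  record _≈_ (x y : ℤ) : Set where
    constructor mk≈
    field modulus∣ : (+ m) ℤ∣ₛ.∣ (x - y)
  open _≈_ public

  ≈⇒≡mod : ∀ {x y} → x ≈ y → x ≡ y [mod m ]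
  ≈⇒≡mod = ℤ∣ₛ.∣⇒∣ᵤ ∘ modulus∣

  ≡mod⇒≈ : ∀ {x y} → x ≡ y [mod m ] → x ≈ y
  ≡mod⇒≈ = mk≈ ∘ ℤ∣ₛ.∣ᵤ⇒∣

  _≈?_ : ∀ x y → Dec (x ≈ y)
  x ≈? y = map′ mk≈ modulus∣ ((+ m) ℤ∣ₛ.∣? (x - y))

  private
    ≈-via : ∀ {x y e} → e ≡ x - y → (+ m) ℤ∣ₛ.∣ e → x ≈ y
    ≈-via refl m∣e = mk≈ m∣e

  ≡⇒≈ : ∀ {x y} → x ≡ y → x ≈ y
  ≡⇒≈ {x} refl = ≈-via (sym (ℤ.i≡j⇒i-j≡0 {x} refl)) (ℤ∣ₛ.∣ᵤ⇒∣ (m ℕ∣.∣0))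

  ≈-refl : ∀ {x} → x ≈ x
  ≈-refl = ≡⇒≈ refl

  ≈-sym : ∀ {x y} → x ≈ y → y ≈ x
  ≈-sym {x} {y} (mk≈ m∣x-y) = ≈-via (negate x y) (ℤ∣ₛ.∣m⇒∣-m m∣x-y)
    where
    negate : ∀ x y → - (x - y) ≡ y - x
    negate = solve-∀

  ≈-trans : ∀ {x y z} → x ≈ y → y ≈ z → x ≈ z
  ≈-trans {x} {y} {z} (mk≈ m∣x-y) (mk≈ m∣y-z) = ≈-via (telescope x y z) (ℤ∣ₛ.∣m∣n⇒∣m+n m∣x-y m∣y-z)
    where
    telescope : ∀ x y z → (x - y) + (y - z) ≡ x - z
    telescope = solve-∀

  ≈-isEquivalence : IsEquivalence _≈_
  ≈-isEquivalence = record { refl = ≈-refl ; sym = ≈-sym ; trans = ≈-trans }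

  ≈-setoid : Setoid _ _
  ≈-setoid = record { isEquivalence = ≈-isEquivalence }

  +-cong : ∀ {x y u v} → x ≈ y → u ≈ v → x + u ≈ y + v
  +-cong {x} {y} {u} {v} (mk≈ m∣x-y) (mk≈ m∣u-v) = ≈-via (regroup x y u v) (ℤ∣ₛ.∣m∣n⇒∣m+n m∣x-y m∣u-v)
    where
    regroup : ∀ x y u v → (x - y) + (u - v) ≡ (x + u) - (y + v)
    regroup = solve-∀

  -‿cong : ∀ {x y} → x ≈ y → - x ≈ - y
  -‿cong {x} {y} (mk≈ m∣x-y) = ≈-via (negate x y) (ℤ∣ₛ.∣m⇒∣-m m∣x-y)
    where
    negate : ∀ x y → - (x - y) ≡ (- x) - (- y)
    negate = solve-∀

  *-cong : ∀ {x y u v} → x ≈ y → u ≈ v → x · u ≈ y · v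
  *-cong {x} {y} {u} {v} (mk≈ m∣x-y) (mk≈ m∣u-v) =
    ≈-via (expand x y u v) (ℤ∣ₛ.∣m∣n⇒∣m+n (ℤ∣ₛ.∣n⇒∣m*n u m∣x-y) (ℤ∣ₛ.∣n⇒∣m*n y m∣u-v))
    where
    expand : ∀ x y u v → u · (x - y) + y · (u - v) ≡ x · u - y · v
    expand = solve-∀

  ^-cong : ∀ {x y} n → x ≈ y → x ^ n ≈ y ^ n
  ^-cong zero    _   = ≈-refl
  ^-cong (suc n) x≈y = *-cong x≈y (^-cong n x≈y)

  ∣-resp-≈ : ∀ {d x y} → d ∣ m → x ≈ y → (+ d) ℤ∣.∣ x → (+ d) ℤ∣.∣ y
  ∣-resp-≈ {d} {x} {y} d∣m (mk≈ m∣x-y) d∣x =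
    ℤ∣ₛ.∣⇒∣ᵤ (subst ((+ d) ℤ∣ₛ.∣_) (x-[x-y]≡y x y) (ℤ∣ₛ.∣m∣n⇒∣m-n (ℤ∣ₛ.∣ᵤ⇒∣ {i = x} d∣x) d∣x-y))
    where
    d∣x-y : (+ d) ℤ∣ₛ.∣ (x - y)
    d∣x-y = ℤ∣ₛ.∣-trans (ℤ∣ₛ.∣ᵤ⇒∣ d∣m) m∣x-y
    x-[x-y]≡y : ∀ x y → x - (x - y) ≡ y
    x-[x-y]≡y = solve-∀

  -1≉1 : 2 < m → ¬ (-1ℤ ≈ 1ℤ)
  -1≉1 2<m -1≈1 = ℕ.<⇒≱ 2<m (ℕ∣.∣⇒≤ (≈⇒≡mod -1≈1))

  module _ .{{_ : NonZero m}} where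

    ≈-%ℕ : ∀ x → x ≈ + (x %ℕ m)
    ≈-%ℕ x = mk≈ (subst (λ t → (+ m) ℤ∣ₛ.∣ (t - + (x %ℕ m))) (sym (a≡a%ℕn+[a/ℕn]*n x m))
                   (subst ((+ m) ℤ∣ₛ.∣_) (quotient-part (+ (x %ℕ m)) (x /ℕ m) (+ m))
                          (ℤ∣ₛ.∣n⇒∣m*n (x /ℕ m) ℤ∣ₛ.∣-refl)))
      where
      quotient-part : ∀ r q d → q · d ≡ (r + q · d) - r
      quotient-part = solve-∀

    %ℕ-≡⇒≈ : ∀ {x y} → x %ℕ m ≡ y %ℕ m → x ≈ y
    %ℕ-≡⇒≈ {x} {y} eq = ≈-trans (≈-%ℕ x) (≈-trans (≡⇒≈ (cong +_ eq)) (≈-sym (≈-%ℕ y)))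

module MultiplicativeOrder (m : ℕ) where
  open Congruence m

  Cancellable : ℤ → Set
  Cancellable z = ∀ {x y} → z · x ≈ z · y → x ≈ y

  Cancellable-^ : ∀ {z} n → Cancellable z → Cancellable (z ^ n)
  Cancellable-^ zero    _      {x} {y} 1x≈1y =
    ≈-trans (≡⇒≈ (sym (ℤ.*-identityˡ x))) (≈-trans 1x≈1y (≡⇒≈ (ℤ.*-identityˡ y)))
  Cancellable-^ {z} (suc n) cancel {x} {y} zzⁿx≈zzⁿy =
    Cancellable-^ n cancel (cancel (≈-trans (≡⇒≈ (sym (ℤ.*-assoc z (z ^ n) x)))
                                     (≈-trans zzⁿx≈zzⁿy (≡⇒≈ (ℤ.*-assoc z (z ^ n) y)))))

  ^-≈1-* : ∀ {z k} q → z ^ k ≈ 1ℤ → z ^ (k * q) ≈ 1ℤ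
  ^-≈1-* {z} {k} q zᵏ≈1 =
    ≈-trans (≡⇒≈ (sym (ℤ.^-*-assoc z k q))) (≈-trans (^-cong q zᵏ≈1) (≡⇒≈ (ℤ.^-zeroˡ q)))

  order⇒^≈1 : ∀ {z k} → IsMultOrder m z k → z ^ k ≈ 1ℤ
  order⇒^≈1 (_ , zᵏ≡1 , _) = ≡mod⇒≈ zᵏ≡1

  IsMultOrder-resp-≈ : ∀ {x y k} → x ≈ y → IsMultOrder m x k → IsMultOrder m y k
  IsMultOrder-resp-≈ {x} {y} {k} x≈y (k>0 , xᵏ≡1 , minimal) =
    k>0 ,
    ≈⇒≡mod (≈-trans (^-cong k (≈-sym x≈y)) (≡mod⇒≈ xᵏ≡1)) ,
    λ j j>0 j<k yʲ≡1 → minimal j j>0 j<k (≈⇒≡mod (≈-trans (^-cong j x≈y) (≡mod⇒≈ yʲ≡1)))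

  HasEvenMultOrder-resp-≈ : ∀ {x y} → x ≈ y → HasEvenMultOrder m x → HasEvenMultOrder m y
  HasEvenMultOrder-resp-≈ x≈y (k , order , 2∣k) = k , IsMultOrder-resp-≈ x≈y order , 2∣k

  order-even : ∀ {z k e} → 2 < m → z ^ k ≈ -1ℤ → IsMultOrder m z e → 2 ∣ e
  order-even {z} {k} {e} 2<m zᵏ≈-1 order with 2 ∣? e
  ... | yes 2∣e = 2∣e
  ... | no 2∤e = contradiction -1≈1 (-1≉1 2<m)
    where
    open Relation.Binary.Reasoning.Setoid ≈-setoid
    -1≈1 : -1ℤ ≈ 1ℤ
    -1≈1 = begin
      -1ℤ           ≡⟨ sym (-1^odd e 2∤e) ⟩
      -1ℤ ^ e       ≈⟨ ^-cong e (≈-sym zᵏ≈-1) ⟩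
      (z ^ k) ^ e   ≡⟨ ℤ.^-*-assoc z k e ⟩
      z ^ (k * e)   ≡⟨ cong (z ^_) (ℕ.*-comm k e) ⟩
      z ^ (e * k)   ≈⟨ ^-≈1-* {z} {e} k (order⇒^≈1 order) ⟩
      1ℤ            ∎

  module _ .{{_ : NonZero m}} where

    -- Pigeonhole on the residues of z⁰, …, zᵐ gives zⁱ ≈ zʲ with i < j; cancel zⁱ.
    ^≈1-exists : ∀ {z} → Cancellable z → ∃ λ N → 0 < N × z ^ N ≈ 1ℤ
    ^≈1-exists {z} cancel with pigeonhole (ℕ.n<1+n m) (λ i → fromℕ< (n%ℕd<d (z ^ toℕ i) m))
    ... | i , j , i<j , same = toℕ j ℕ.∸ toℕ i , ℕ.m<n⇒0<n∸m i<j , Cancellable-^ (toℕ i) cancel zⁱ·zʲ⁻ⁱ≈zⁱ·1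
      where
      open Relation.Binary.Reasoning.Setoid ≈-setoid
      zⁱ≈zʲ : z ^ toℕ i ≈ z ^ toℕ j
      zⁱ≈zʲ = %ℕ-≡⇒≈ (trans (sym (toℕ-fromℕ< (n%ℕd<d (z ^ toℕ i) m)))
                         (trans (cong toℕ same) (toℕ-fromℕ< (n%ℕd<d (z ^ toℕ j) m))))
      zⁱ·zʲ⁻ⁱ≈zⁱ·1 : z ^ toℕ i · z ^ (toℕ j ℕ.∸ toℕ i) ≈ z ^ toℕ i · 1ℤ
      zⁱ·zʲ⁻ⁱ≈zⁱ·1 = begin
        z ^ toℕ i · z ^ (toℕ j ℕ.∸ toℕ i) ≡⟨ sym (ℤ.^-distribˡ-+-* z (toℕ i) (toℕ j ℕ.∸ toℕ i)) ⟩
        z ^ (toℕ i ℕ.+ (toℕ j ℕ.∸ toℕ i)) ≡⟨ cong (z ^_) (ℕ.m+[n∸m]≡n (ℕ.<⇒≤ i<j)) ⟩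
        z ^ toℕ j                         ≈⟨ ≈-sym zⁱ≈zʲ ⟩
        z ^ toℕ i                         ≡⟨ sym (ℤ.*-identityʳ (z ^ toℕ i)) ⟩
        z ^ toℕ i · 1ℤ                    ∎

    order-exists : ∀ {z} → Cancellable z → ∃ (IsMultOrder m z)
    order-exists {z} cancel = least⇒order (least-such P? (proj₂ (^≈1-exists cancel)))
      where
      P : ℕ → Set
      P k = 0 < k × z ^ k ≈ 1ℤ
      P? : Decidable P
      P? k = (0 ℕ.<? k) ×-dec (z ^ k ≈? 1ℤ)
      least⇒order : ∃ (Least P) → ∃ (IsMultOrder m z)
      least⇒order (k , (k>0 , zᵏ≈1) , minimal) =
        k , k>0 , ≈⇒≡mod zᵏ≈1 , λ j j>0 j<k zʲ≡1 → minimal j j<k (j>0 , ≡mod⇒≈ zʲ≡1)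

prime²-cancel : ∀ {p u v} → Prime p → ¬ p ∣ u → p * p ∣ u * v → p * p ∣ v
prime²-cancel {p} {u} {v} pp p∤u p²∣uv
  with euclidsLemma u v pp (ℕ∣.∣-trans (ℕ∣.∣m⇒∣m*n p ℕ∣.∣-refl) p²∣uv)
... | inj₁ p∣u = contradiction p∣u p∤u
... | inj₂ (divides q refl) = ℕ∣.*-monoˡ-∣ p p∣q
  where
  p∣uq : p ∣ u * q
  p∣uq = ℕ∣.*-cancelʳ-∣ p {{prime⇒nonZero pp}} (subst (p * p ∣_) (sym (ℕ.*-assoc u q p)) p²∣uv)
  p∣q : p ∣ q
  p∣q with euclidsLemma u q pp p∣uq
  ... | inj₁ p∣u = contradiction p∣u p∤u
  ... | inj₂ p∣q = p∣q

prime∤-* : ∀ {p} x y → Prime p → ¬ (+ p) ℤ∣.∣ x → ¬ (+ p) ℤ∣.∣ y → ¬ (+ p) ℤ∣.∣ (x · y)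
prime∤-* {p} x y pp p∤x p∤y p∣xy
  with euclidsLemma ∣ x ∣ ∣ y ∣ pp (subst (p ∣_) (ℤ.abs-* x y) p∣xy)
... | inj₁ p∣x = p∤x p∣x
... | inj₂ p∣y = p∤y p∣y

module PthPowers {p : ℕ} (pp : Prime p) where
  open Congruence (p * p)
  open MultiplicativeOrder (p * p)

  NonzeroPthPowerMod-resp-≈ : ∀ {x y} → x ≈ y → NonzeroPthPowerMod p x → NonzeroPthPowerMod p y
  NonzeroPthPowerMod-resp-≈ {x} x≈y ((a , x≡aᵖ) , p∤x) =
    (a , ≈⇒≡mod (≈-trans (≈-sym x≈y) (≡mod⇒≈ {x} x≡aᵖ))) ,
    p∤x ∘ ∣-resp-≈ (ℕ∣.∣m⇒∣m*n p ℕ∣.∣-refl) (≈-sym x≈y)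

  NonzeroPthPowerMod-1 : NonzeroPthPowerMod p 1ℤ
  NonzeroPthPowerMod-1 =
    (1ℤ , ≈⇒≡mod (≡⇒≈ (sym (ℤ.^-zeroˡ p)))) ,
    λ p∣1 → ℕ.nonTrivial⇒≢1 {{prime⇒nonTrivial pp}} (ℕ∣.∣1⇒≡1 p∣1)

  NonzeroPthPowerMod-* : ∀ x y → NonzeroPthPowerMod p x → NonzeroPthPowerMod p y →
                         NonzeroPthPowerMod p (x · y)
  NonzeroPthPowerMod-* x y ((a , x≡aᵖ) , p∤x) ((b , y≡bᵖ) , p∤y) =
    (a · b , ≈⇒≡mod (≈-trans (*-cong (≡mod⇒≈ {x} x≡aᵖ) (≡mod⇒≈ {y} y≡bᵖ))
                             (≡⇒≈ (sym (^-distribʳ-* a b p))))) ,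
    prime∤-* x y pp p∤x p∤y

  NonzeroPthPowerMod-^ : ∀ x n → NonzeroPthPowerMod p x → NonzeroPthPowerMod p (x ^ n)
  NonzeroPthPowerMod-^ x zero    _  = NonzeroPthPowerMod-1
  NonzeroPthPowerMod-^ x (suc n) xᵖ = NonzeroPthPowerMod-* x (x ^ n) xᵖ (NonzeroPthPowerMod-^ x n xᵖ)

  NonzeroPthPowerMod-neg : ¬ 2 ∣ p → ∀ x → NonzeroPthPowerMod p x → NonzeroPthPowerMod p (- x)
  NonzeroPthPowerMod-neg 2∤p x ((a , x≡aᵖ) , p∤x) =
    (- a , ≈⇒≡mod (≈-trans (-‿cong (≡mod⇒≈ {x} x≡aᵖ)) (≡⇒≈ (sym (-‿^-odd a p 2∤p))))) ,
    p∤x ∘ subst (p ∣_) (ℤ.∣-i∣≡∣i∣ x)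

  NonzeroPthPowerMod⇒Cancellable : ∀ z → NonzeroPthPowerMod p z → Cancellable z
  NonzeroPthPowerMod⇒Cancellable z (_ , p∤z) {x} {y} (mk≈ p²∣zx-zy) =
    ≡mod⇒≈ (prime²-cancel pp p∤z (subst (p * p ∣_) (ℤ.abs-* z (x - y))
      (ℤ∣ₛ.∣⇒∣ᵤ (subst ((+ (p * p)) ℤ∣ₛ.∣_) (factor z x y) p²∣zx-zy))))
    where
    factor : ∀ z x y → z · x - z · y ≡ z · (x - y)
    factor = solve-∀

EvenComplement : ℕ → ℤ → Set
EvenComplement p x =
  NonzeroPthPowerMod p x × NonzeroPthPowerMod p (+ 1 - x) × HasEvenMultOrder (p * p) (+ 1 - x)

module OddPrime {p : ℕ} (pp : Prime p) (2∤p : ¬ 2 ∣ p) where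
  open Congruence (p * p)
  open MultiplicativeOrder (p * p)
  open PthPowers pp

  private
    instance
      p≢0 : NonZero p
      p≢0 = prime⇒nonZero pp
      p²≢0 : NonZero (p * p)
      p²≢0 = ℕ.m*n≢0 p p

    2<p² : 2 < p * p
    2<p² = ℕ.≤-trans (ℕ.n≤1+n 3) (ℕ.*-mono-≤ p>1 p>1)
      where
      p>1 : 1 < p
      p>1 = ℕ.nonTrivial⇒n>1 p {{prime⇒nonTrivial pp}}

  record OneSplitting (P Q : ℤ) : Set where
    constructor splitting
    field
      P-pow : NonzeroPthPowerMod p P
      Q-pow : NonzeroPthPowerMod p Q
      P+Q≈1 : P + Q ≈ 1ℤ

  EvenSplitting : ℤ → ℤ → Set
  EvenSplitting P Q = OneSplitting P Q × HasEvenMultOrder (p * p) Q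

  OneSplitting-sym : ∀ {P Q} → OneSplitting P Q → OneSplitting Q P
  OneSplitting-sym {P} {Q} (splitting P-pow Q-pow P+Q≈1) =
    splitting Q-pow P-pow (≈-trans (≡⇒≈ (ℤ.+-comm Q P)) P+Q≈1)

  consecutive⇒OneSplitting : ∀ x y → NonzeroPthPowerMod p x → NonzeroPthPowerMod p y →
                             Consecutive p x y → ∃₂ OneSplitting
  consecutive⇒OneSplitting x y x-pow y-pow (inj₁ y-x≡1) =
    - x , y , splitting (NonzeroPthPowerMod-neg 2∤p x x-pow) y-pow
                        (≈-trans (≡⇒≈ (ℤ.+-comm (- x) y)) (≡mod⇒≈ {y - x} y-x≡1))
  consecutive⇒OneSplitting x y x-pow y-pow (inj₂ y-x≡-1) =
    - y , x , splitting (NonzeroPthPowerMod-neg 2∤p y y-pow) x-pow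
                        (≈-trans (≡⇒≈ (negate x y)) (-‿cong (≡mod⇒≈ {y - x} { -1ℤ} y-x≡-1)))
    where
    negate : ∀ x y → - y + x ≡ - (y - x)
    negate = solve-∀

  OneSplitting-inverse : ∀ {P Q} I → OneSplitting P Q → NonzeroPthPowerMod p I → P · I ≈ 1ℤ →
                         OneSplitting I (- (Q · I))
  OneSplitting-inverse {P} {Q} I (splitting _ Q-pow P+Q≈1) I-pow PI≈1 =
    splitting I-pow (NonzeroPthPowerMod-neg 2∤p (Q · I) (NonzeroPthPowerMod-* Q I Q-pow I-pow)) I-QI≈1
    where
    open Relation.Binary.Reasoning.Setoid ≈-setoid
    expand : ∀ I Q → I + - (Q · I) ≡ 1ℤ · I - Q · I
    expand = solve-∀
    collect : ∀ P Q I → (P + Q) · I - Q · I ≡ P · I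
    collect = solve-∀
    I-QI≈1 : I + - (Q · I) ≈ 1ℤ
    I-QI≈1 = begin
      I + - (Q · I)         ≡⟨ expand I Q ⟩
      1ℤ · I - Q · I        ≈⟨ +-cong (*-cong (≈-sym P+Q≈1) ≈-refl) ≈-refl ⟩
      (P + Q) · I - Q · I   ≡⟨ collect P Q I ⟩
      P · I                 ≈⟨ PI≈1 ⟩
      1ℤ                    ∎

  oddOrders⇒EvenSplitting : ∀ {P Q n m} → OneSplitting P Q →
                            IsMultOrder (p * p) P n → IsMultOrder (p * p) Q m → ¬ 2 ∣ n → ¬ 2 ∣ m →
                            ∃₂ EvenSplitting
  oddOrders⇒EvenSplitting {P} {Q} {suc n′} {m} split ordP ordQ 2∤n 2∤m = I , w , split′ , wᵉᵛᵉⁿ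
    where
    open Relation.Binary.Reasoning.Setoid ≈-setoid
    n : ℕ
    n = suc n′
    I : ℤ
    I = P ^ n′
    w : ℤ
    w = - (Q · I)
    split′ : OneSplitting I w
    split′ = OneSplitting-inverse I split (NonzeroPthPowerMod-^ P n′ (OneSplitting.P-pow split))
                                          (order⇒^≈1 ordP)
    Iⁿ≈1 : I ^ n ≈ 1ℤ
    Iⁿ≈1 = ≈-trans (≡⇒≈ (trans (ℤ.^-*-assoc P n′ n) (cong (P ^_) (ℕ.*-comm n′ n))))
                   (^-≈1-* {P} {n} n′ (order⇒^≈1 ordP))
    Qⁿᵐ≈1 : Q ^ (n * m) ≈ 1ℤ
    Qⁿᵐ≈1 = ≈-trans (≡⇒≈ (cong (Q ^_) (ℕ.*-comm n m))) (^-≈1-* {Q} {m} n (order⇒^≈1 ordQ))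
    wⁿᵐ≈-1 : w ^ (n * m) ≈ -1ℤ
    wⁿᵐ≈-1 = begin
      (- (Q · I)) ^ (n * m)          ≡⟨ -‿^-odd (Q · I) (n * m) (odd*odd n m 2∤n 2∤m) ⟩
      - ((Q · I) ^ (n * m))          ≡⟨ cong -_ (^-distribʳ-* Q I (n * m)) ⟩
      - (Q ^ (n * m) · I ^ (n * m))  ≈⟨ -‿cong (*-cong Qⁿᵐ≈1 (^-≈1-* {I} {n} m Iⁿ≈1)) ⟩
      - (1ℤ · 1ℤ)                    ≡⟨⟩
      -1ℤ                            ∎
    wᵉᵛᵉⁿ : HasEvenMultOrder (p * p) w
    wᵉᵛᵉⁿ = even (order-exists (NonzeroPthPowerMod⇒Cancellable w (OneSplitting.Q-pow split′)))
      where
      even : ∃ (IsMultOrder (p * p) w) → HasEvenMultOrder (p * p) w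
      even (e , ordw) = e , ordw , order-even {w} {n * m} 2<p² wⁿᵐ≈-1 ordw

  OneSplitting⇒EvenSplitting : ∀ {P Q} → OneSplitting P Q → ∃₂ EvenSplitting
  OneSplitting⇒EvenSplitting {P} {Q} split@(splitting P-pow Q-pow _) =
    by-parity (order-exists (NonzeroPthPowerMod⇒Cancellable P P-pow))
              (order-exists (NonzeroPthPowerMod⇒Cancellable Q Q-pow))
    where
    by-parity : ∃ (IsMultOrder (p * p) P) → ∃ (IsMultOrder (p * p) Q) → ∃₂ EvenSplitting
    by-parity (n , ordP) (m , ordQ) with 2 ∣? n | 2 ∣? m
    ... | _       | yes 2∣m = P , Q , split , m , ordQ , 2∣m
    ... | yes 2∣n | no _    = Q , P , OneSplitting-sym split , n , ordP , 2∣n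
    ... | no 2∤n  | no 2∤m  = oddOrders⇒EvenSplitting split ordP ordQ 2∤n 2∤m

  EvenSplitting⇒EvenComplement : ∀ {P Q} → EvenSplitting P Q → EvenComplement p P
  EvenSplitting⇒EvenComplement {P} {Q} (splitting P-pow Q-pow P+Q≈1 , Qᵉᵛᵉⁿ) =
    P-pow , NonzeroPthPowerMod-resp-≈ Q≈1-P Q-pow , HasEvenMultOrder-resp-≈ Q≈1-P Qᵉᵛᵉⁿ
    where
    Q≡[P+Q]-P : ∀ P Q → Q ≡ (P + Q) - P
    Q≡[P+Q]-P = solve-∀
    Q≈1-P : Q ≈ + 1 - P
    Q≈1-P = ≈-trans (≡⇒≈ (Q≡[P+Q]-P P Q)) (+-cong P+Q≈1 ≈-refl)

  consecutive⇒EvenComplement : ∀ x y → NonzeroPthPowerMod p x → NonzeroPthPowerMod p y →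
                               Consecutive p x y → ∃ (EvenComplement p)
  consecutive⇒EvenComplement x y x-pow y-pow consecutive =
    let _ , _ , split = consecutive⇒OneSplitting x y x-pow y-pow consecutive
        P , _ , even  = OneSplitting⇒EvenSplitting split
    in P , EvenSplitting⇒EvenComplement even

module SquaresMod4 where
  open Congruence 4

  NonzeroPthPowerMod-2⇒≈1 : ∀ x → NonzeroPthPowerMod 2 x → x ≈ 1ℤ
  NonzeroPthPowerMod-2⇒≈1 x ((a , x≡a²) , 2∤x) = by-parity (a %ℕ 2) refl (n%ℕd<d a 2)
    where
    x≈a² : x ≈ a ^ 2
    x≈a² = ≡mod⇒≈ {x} x≡a²
    a≡r+2q : ∀ {r} → a %ℕ 2 ≡ r → a ≡ + r + (a /ℕ 2) · + 2
    a≡r+2q refl = a≡a%ℕn+[a/ℕn]*n a 2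
    by-parity : ∀ r → a %ℕ 2 ≡ r → r < 2 → x ≈ 1ℤ
    by-parity 0 a%2≡0 _ = contradiction (∣-resp-≈ (divides 2 refl) (≈-sym x≈a²) 2∣a²) 2∤x
      where
      2∣a : (+ 2) ℤ∣ₛ.∣ a
      2∣a = subst ((+ 2) ℤ∣ₛ.∣_) (trans (sym (ℤ.+-identityˡ _)) (sym (a≡r+2q a%2≡0)))
                  (ℤ∣ₛ.∣n⇒∣m*n (a /ℕ 2) ℤ∣ₛ.∣-refl)
      2∣a² : (+ 2) ℤ∣.∣ (a ^ 2)
      2∣a² = ℤ∣ₛ.∣⇒∣ᵤ (ℤ∣ₛ.∣m⇒∣m*n (a · 1ℤ) 2∣a)
    by-parity 1 a%2≡1 _ = ≈-trans x≈a² (mk≈ 4∣a²-1)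
      where
      odd-square : ∀ q → + 4 · (q · (q + 1ℤ)) ≡ (+ 1 + q · + 2) · ((+ 1 + q · + 2) · 1ℤ) - 1ℤ
      odd-square = solve-∀
      4∣a²-1 : (+ 4) ℤ∣ₛ.∣ (a ^ 2 - 1ℤ)
      4∣a²-1 = subst (λ b → (+ 4) ℤ∣ₛ.∣ (b ^ 2 - 1ℤ)) (sym (a≡r+2q a%2≡1))
                 (subst ((+ 4) ℤ∣ₛ.∣_) (odd-square (a /ℕ 2)) (ℤ∣ₛ.∣m⇒∣m*n (a /ℕ 2 · (a /ℕ 2 + 1ℤ)) ℤ∣ₛ.∣-refl))
    by-parity (suc (suc _)) _ (s≤s (s≤s ()))

  ¬InPcons-2 : ¬ InPcons 2
  ¬InPcons-2 (_ , x , y , x-pow , y-pow , consecutive) = ±1≉0 consecutive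
    where
    y-x≈0 : y - x ≈ 0ℤ
    y-x≈0 = +-cong (NonzeroPthPowerMod-2⇒≈1 y y-pow) (-‿cong (NonzeroPthPowerMod-2⇒≈1 x x-pow))
    4∤1 : ¬ 4 ∣ 1
    4∤1 4∣1 with ℕ∣.∣1⇒≡1 4∣1
    ... | ()
    ±1≉0 : Consecutive 2 x y → ⊥
    ±1≉0 (inj₁ y-x≡1)  = 4∤1 (≈⇒≡mod (≈-trans (≈-sym (≡mod⇒≈ {y - x} y-x≡1)) y-x≈0))
    ±1≉0 (inj₂ y-x≡-1) = 4∤1 (≈⇒≡mod (≈-trans (≈-sym (≡mod⇒≈ {y - x} { -1ℤ} y-x≡-1)) y-x≈0))

prime≢2⇒odd : ∀ {p} → Prime p → p ≢ 2 → ¬ 2 ∣ p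
prime≢2⇒odd pp p≢2 2∣p with prime⇒irreducible pp 2∣p
... | inj₁ ()
... | inj₂ 2≡p = p≢2 (sym 2≡p)

lemma3p7 : (p : ℕ) → InPcons p →
    ∃ λ (x : ℤ) →
      NonzeroPthPowerMod p x × NonzeroPthPowerMod p (+ 1 - x) ×
      HasEvenMultOrder (p * p) (+ 1 - x)
lemma3p7 p p∈Pcons@(pp , x , y , x-pow , y-pow , consecutive) with p ℕ.≟ 2
... | yes refl = ⊥-elim (SquaresMod4.¬InPcons-2 p∈Pcons)
... | no p≢2   = OddPrime.consecutive⇒EvenComplement pp (prime≢2⇒odd pp p≢2) x y x-pow y-pow consecutive
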